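{- Let $G$ be a multigraph in which each edge $\{u,v\}\in E(G)$ appears at most twice in $E(G)$, and let $\mathsf{VC}$ be a vertex cover of $G$. Assume every vertex of $G$ has even degree. Then there exists a multiset $\mathcal{C}$ of cycles in $G$ such that: (1) at most $2|\mathsf{VC}|^2$ cycles in $\mathcal{C}$ have length other than $4$; (2) the cycles in $\mathcal{C}$ of length other than $4$ are simple; (3) $\bigcup_{C\in\mathcal{C}}E(C)=E(G)$ as multisets.
   Context: A cycle is a sequence $(v_0,\ldots,v_\ell)$ of vertices with $v_0=v_\ell$ and $\{v_i,v_{i+1}\}\in E(G)$ for each $i$ (vertices may repeat); its length is $\ell$ and $E(C)$ is the multiset $\{\{v_i,v_{i+1}\}:0\le i\le \ell-1\}$. A cycle is simple if $v_i\ne v_j$ for all $0\le i<j\le \ell-1$. Degree counts edge multiplicities. The union of multisets in (3) is the multiset sum (multiplicities add). -}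

module Defs where

open import Data.Nat using (ℕ; zero; suc; _≤_; _*_; _^_)
open import Data.Nat.Divisibility using (_∣_)
open import Data.Fin using (Fin; zero; suc; fromℕ; inject₁; _≟_)
open import Data.Fin.Subset using (Subset; _∈_; ∣_∣)
open import Data.List using (List; length; filter; map; concatMap; allFin)
open import Data.List.Relation.Unary.All using (All)
open import Data.List.Relation.Unary.Any using (Any)
open import Data.Product using (_×_; _,_; proj₁; proj₂)
open import Data.Sum using (_⊎_)
open import Relation.Binary.PropositionalEquality using (_≡_; _≢_)
open import Relation.Nullary using (¬_; Dec)
open import Relation.Nullary.Decidable using (_⊎-dec_; _×-dec_)

-- An (undirected) edge between two vertices, given by its two endpoints
-- (the order of the endpoints is irrelevant, see SameEdge).
Edge : ℕ → Set
Edge n = Fin n × Fin n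

-- A multigraph on vertex set Fin n: a finite list (= multiset) of edges.
-- Loopless: every edge has two distinct endpoints.
record Multigraph (n : ℕ) : Set where
  field
    edges    : List (Edge n)
    loopless : All (λ e → proj₁ e ≢ proj₂ e) edges
open Multigraph public

SameEdge : ∀ {n} → Edge n → Edge n → Set
SameEdge (a , b) (u , v) = (a ≡ u × b ≡ v) ⊎ (a ≡ v × b ≡ u)

sameEdge? : ∀ {n} (e f : Edge n) → Dec (SameEdge e f)
sameEdge? (a , b) (u , v) = ((a ≟ u) ×-dec (b ≟ v)) ⊎-dec ((a ≟ v) ×-dec (b ≟ u))

mult : ∀ {n} → List (Edge n) → Fin n → Fin n → ℕ
mult L u v = length (filter (λ e → sameEdge? e (u , v)) L)

-- Degree of v (counting multiplicities; graphs are loopless).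
Incident : ∀ {n} → Fin n → Edge n → Set
Incident v (a , b) = (a ≡ v) ⊎ (b ≡ v)

incident? : ∀ {n} (v : Fin n) (e : Edge n) → Dec (Incident v e)
incident? v (a , b) = (a ≟ v) ⊎-dec (b ≟ v)

degree : ∀ {n} → Multigraph n → Fin n → ℕ
degree G v = length (filter (incident? v) (edges G))

IsVertexCover : ∀ {n} → Multigraph n → Subset n → Set
IsVertexCover G VC = All (λ e → proj₁ e ∈ VC ⊎ proj₂ e ∈ VC) (edges G)

-- A closed walk (v_0, ..., v_ℓ) with v_0 = v_ℓ; length ℓ.
record Cycle (n : ℕ) : Set where
  field
    len    : ℕ
    vtx    : Fin (suc len) → Fin n
    closed : vtx zero ≡ vtx (fromℕ len)
open Cycle public

cycleEdge : ∀ {n} (C : Cycle n) → Fin (len C) → Edge n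
cycleEdge C i = vtx C (inject₁ i) , vtx C (suc i)

cycleEdges : ∀ {n} → Cycle n → List (Edge n)
cycleEdges C = map (cycleEdge C) (allFin (len C))

_∈E_ : ∀ {n} → Edge n → Multigraph n → Set
e ∈E G = Any (SameEdge e) (edges G)

IsCycleIn : ∀ {n} → Multigraph n → Cycle n → Set
IsCycleIn G C = ∀ (i : Fin (len C)) → cycleEdge C i ∈E G

IsSimple : ∀ {n} → Cycle n → Set
IsSimple C = ∀ (i j : Fin (len C)) → i ≢ j → vtx C (inject₁ i) ≢ vtx C (inject₁ j)

-- Every edge with an endpoint w outside the vertex cover VC has its other endpoint in VC, and w
-- has even degree, so the edges at w pair up into cherries x – w – y with x, y ∈ VC.  Two cherries
-- with the same ends (x, y) form the closed walk x w y w′ x of length 4; the cherries left unpaired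
-- have pairwise distinct ends, so there are at most |VC|² of them.  The remaining edges join two
-- vertices of VC and, as each occurs at most twice, can be oriented without repetition, so there are
-- at most |VC|² of them too.  These edges and the unpaired cherries again have even degrees, and
-- walking along unused edges until a vertex repeats splits them into simple cycles of length at
-- least 2, of which there are at most |VC|² + |VC|².

module Submission where

open import Defs
open import Level using (0ℓ)
open import Function using (_∘_)
open import Data.Empty using (⊥-elim)
open import Data.Unit using (⊤; tt)
open import Data.Product using (Σ; Σ-syntax; ∃; ∃₂; _×_; _,_; proj₁; proj₂)
open import Data.Product.Properties using (≡-dec)
open import Data.Sum using (_⊎_; inj₁; inj₂)
open import Data.Nat using (ℕ; zero; suc; _≤_; _<_; _*_; _+_; _^_; z≤n; s≤s; _≟_)
open import Data.Nat.Properties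
  using (≤-refl; ≤-trans; ≤-reflexive; ≤⇒≯; n≤1+n; m≤n+m; m≤m+n; +-identityʳ; *-identityʳ; *-suc;
         +-mono-≤; +-monoˡ-≤; +-monoʳ-≤; *-monoʳ-≤; *-cancelˡ-≤; module ≤-Reasoning)
open import Data.Nat.Divisibility using (_∣_; _∣0; divides; ∣m∣n⇒∣m+n; ∣m+n∣m⇒∣n; ∣1⇒≡1; m∣m*n)
open import Data.Nat.Induction using (<-wellFounded)
open import Data.Nat.Tactic.RingSolver using (solve-∀)
open import Induction.WellFounded using (Acc; acc)
open import Data.Fin using (Fin; zero; suc; fromℕ; inject₁) renaming (_≟_ to _≟ᶠ_)
open import Data.Fin.Properties using (injective⇒≤)
open import Data.Fin.Subset using (Subset; inside; outside; ∣_∣) renaming (_∈_ to _∈ₛ_; _∉_ to _∉ₛ_)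
open import Data.Fin.Subset.Properties using () renaming (_∈?_ to _∈ₛ?_)
open import Data.Vec using (here; there) renaming ([] to []ᵥ; _∷_ to _∷ᵥ_)
open import Data.List using (List; []; _∷_; _++_; [_]; length; filter; map; concat; concatMap; tabulate; lookup; cartesianProduct)
open import Data.List.Properties
  using (length-++; length-map; length-filter; filter-++; filter-accept; filter-none; filter-all;
         map-tabulate; map-∘; map-cong; ++-assoc; ++-identityʳ)
open import Data.List.Relation.Unary.All as All using (All; []; _∷_)
open import Data.List.Relation.Unary.All.Properties
  using (¬Any⇒All¬; ++⁻ˡ; ++⁻ʳ; concat⁻) renaming (map⁺ to All-map⁺; map⁻ to All-map⁻; ++⁺ to All-++⁺)
open import Data.List.Relation.Unary.Any as Any using (Any; here; there; any?)
open import Data.List.Relation.Unary.Any.Properties using (lookup-index)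
open import Data.List.Relation.Unary.AllPairs using ([]; _∷_)
open import Data.List.Relation.Unary.Unique.Propositional using (Unique)
open import Data.List.Relation.Unary.Unique.Propositional.Properties using (Unique[x∷xs]⇒x∉xs; drop⁺)
open import Data.List.Membership.Propositional using (_∈_; _∉_; find; lose)
open import Data.List.Membership.Propositional.Properties using (∈-∃++; ∈-lookup; ∈-cartesianProduct⁺; ∈-map⁺; ∈-allFin)
import Data.List.Membership.DecPropositional as DecMembership
open import Data.List.Relation.Binary.Pointwise using (Pointwise; []; _∷_)
open import Data.List.Relation.Binary.Permutation.Propositional as Perm using (_↭_; ↭-refl; ↭-trans; ↭-prep; ↭-swap; ↭⇒↭ₛ)
open import Data.List.Relation.Binary.Permutation.Propositional.Properties
  using (↭-length; filter-↭; shift; shifts; ++⁺ʳ; ++⁺ˡ; ++-comm; All-resp-↭) renaming (map⁺ to ↭-map⁺)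
import Data.List.Relation.Binary.Permutation.Setoid.Properties as SetoidPermutation
open import Relation.Binary using (DecidableEquality; DecSetoid; Setoid; IsEquivalence; _Respects_)
import Relation.Binary.Reasoning.Setoid as SetoidReasoning
open import Relation.Binary.PropositionalEquality
  using (_≡_; _≢_; refl; sym; trans; cong; cong₂; subst; setoid; module ≡-Reasoning)
open import Relation.Nullary using (¬_; Dec; yes; no; ¬?)
open import Relation.Nullary.Decidable using (_⊎-dec_; decidable-stable)
open import Relation.Unary using (Pred; Decidable; ∁)

module _ {A : Set} {P : Pred A 0ℓ} (P? : Decidable P) where

  count : List A → ℕ
  count xs = length (filter P? xs)

  count-++ : ∀ xs ys → count (xs ++ ys) ≡ count xs + count ys
  count-++ xs ys = trans (cong length (filter-++ P? xs ys)) (length-++ (filter P? xs))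

  count-↭ : ∀ {xs ys} → xs ↭ ys → count xs ≡ count ys
  count-↭ xs↭ys = ↭-length (filter-↭ P? xs↭ys)

  count-accept : ∀ {x} xs → P x → count (x ∷ xs) ≡ suc (count xs)
  count-accept _ px = cong length (filter-accept P? px)

  count-none : ∀ {xs} → All (∁ P) xs → count xs ≡ 0
  count-none ¬ps = cong length (filter-none P? ¬ps)

  count-≤-++ʳ : ∀ xs ys → count ys ≤ count (xs ++ ys)
  count-≤-++ʳ xs ys = ≤-trans (m≤n+m (count ys) (count xs)) (≤-reflexive (sym (count-++ xs ys)))

  count-≤-++ˡ : ∀ xs ys → count xs ≤ count (xs ++ ys)
  count-≤-++ˡ xs ys = ≤-trans (m≤m+n (count xs) (count ys)) (≤-reflexive (sym (count-++ xs ys)))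

  count-pos⇒Any : ∀ {xs} → 0 < count xs → Any P xs
  count-pos⇒Any {x ∷ xs} pos with P? x
  ... | yes px = here px
  ... | no _   = there (count-pos⇒Any pos)

  Any⇒count-pos : ∀ {xs} → Any P xs → 0 < count xs
  Any⇒count-pos (here px)          = ≤-trans (s≤s z≤n) (≤-reflexive (sym (count-accept _ px)))
  Any⇒count-pos {x ∷ xs} (there p) = ≤-trans (Any⇒count-pos p) (count-≤-++ʳ [ x ] xs)

  distinct-members⇒2≤count : ∀ {x y xs} → x ≢ y → x ∈ xs → y ∈ xs → P x → P y → 2 ≤ count xs
  distinct-members⇒2≤count x≢y (here refl) (here refl) _ _ = ⊥-elim (x≢y refl)
  distinct-members⇒2≤count x≢y (here refl) (there y∈) px py =
    ≤-trans (s≤s (Any⇒count-pos (lose y∈ py))) (≤-reflexive (sym (count-accept _ px)))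
  distinct-members⇒2≤count x≢y (there x∈) (here refl) px py =
    ≤-trans (s≤s (Any⇒count-pos (lose x∈ px))) (≤-reflexive (sym (count-accept _ py)))
  distinct-members⇒2≤count {xs = z ∷ zs} x≢y (there x∈) (there y∈) px py =
    ≤-trans (distinct-members⇒2≤count x≢y x∈ y∈ px py) (count-≤-++ʳ [ z ] zs)

Any-↭∷ : ∀ {A : Set} {P : Pred A 0ℓ} {xs} → Any P xs → ∃ λ x → P x × ∃ λ xs′ → xs ↭ x ∷ xs′
Any-↭∷ p with x , x∈ , px ← find p with ys , zs , refl ← ∈-∃++ x∈ = x , px , ys ++ zs , shift x ys zs

Unique-resp-↭ : ∀ {A : Set} {xs ys : List A} → xs ↭ ys → Unique xs → Unique ys
Unique-resp-↭ xs↭ys = SetoidPermutation.Unique-resp-↭ (setoid _) (↭⇒↭ₛ xs↭ys)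

Unique-++⁻ˡ : ∀ {A : Set} (xs : List A) {ys} → Unique (xs ++ ys) → Unique xs
Unique-++⁻ˡ []       _           = []
Unique-++⁻ˡ (x ∷ xs) (x∉ ∷ uniq) = ++⁻ˡ xs x∉ ∷ Unique-++⁻ˡ xs uniq

2∣suc⇒pos : ∀ {m} → 2 ∣ suc m → 0 < m
2∣suc⇒pos {zero}  2∣1 with () ← ∣1⇒≡1 2∣1
2∣suc⇒pos {suc m} _   = s≤s z≤n

Unique-lookup-injective : ∀ {A : Set} {xs : List A} → Unique xs → ∀ {i j} → lookup xs i ≡ lookup xs j → i ≡ j
Unique-lookup-injective {xs = _ ∷ _}  _          {zero}  {zero}  _  = refl
Unique-lookup-injective {xs = _ ∷ xs} (x∉ ∷ _)   {zero}  {suc j} eq = ⊥-elim (All.lookup x∉ (∈-lookup j) eq)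
Unique-lookup-injective {xs = _ ∷ xs} (x∉ ∷ _)   {suc i} {zero}  eq = ⊥-elim (All.lookup x∉ (∈-lookup i) (sym eq))
Unique-lookup-injective {xs = _ ∷ _}  (_ ∷ uniq) {suc i} {suc j} eq = cong suc (Unique-lookup-injective uniq eq)

Unique⊆⇒length≤ : ∀ {A : Set} {xs ys : List A} → Unique xs → All (_∈ ys) xs → length xs ≤ length ys
Unique⊆⇒length≤ {xs = xs} {ys} uniq xs⊆ys = injective⇒≤ position-injective
  where
  position : Fin (length xs) → Fin (length ys)
  position i = Any.index (All.lookup xs⊆ys (∈-lookup i))

  position-injective : ∀ {i j} → position i ≡ position j → i ≡ j
  position-injective {i} {j} eq = Unique-lookup-injective uniq (begin
    lookup xs i              ≡⟨ lookup-index (All.lookup xs⊆ys (∈-lookup i)) ⟩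
    lookup ys (position i)   ≡⟨ cong (lookup ys) eq ⟩
    lookup ys (position j)   ≡⟨ lookup-index (All.lookup xs⊆ys (∈-lookup j)) ⟨
    lookup xs j              ∎)
    where open ≡-Reasoning

length-cartesianProduct : ∀ {A B : Set} (xs : List A) (ys : List B) →
                          length (cartesianProduct xs ys) ≡ length xs * length ys
length-cartesianProduct []       ys = refl
length-cartesianProduct (x ∷ xs) ys = trans (length-++ (map (x ,_) ys))
  (cong₂ _+_ (length-map (x ,_) ys) (length-cartesianProduct xs ys))

members : ∀ {n} → Subset n → List (Fin n)
members []ᵥ             = []
members (inside  ∷ᵥ p) = zero ∷ map suc (members p)
members (outside ∷ᵥ p) = map suc (members p)

length-members : ∀ {n} (p : Subset n) → length (members p) ≡ ∣ p ∣
length-members []ᵥ             = refl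
length-members (inside  ∷ᵥ p) = cong suc (trans (length-map suc (members p)) (length-members p))
length-members (outside ∷ᵥ p) = trans (length-map suc (members p)) (length-members p)

∈-members : ∀ {n} {p : Subset n} {x} → x ∈ₛ p → x ∈ members p
∈-members {p = inside  ∷ᵥ p} here          = here refl
∈-members {p = inside  ∷ᵥ p} (there x∈p)   = there (∈-map⁺ suc (∈-members x∈p))
∈-members {p = outside ∷ᵥ p} (there x∈p)   = ∈-map⁺ suc (∈-members x∈p)

concatMap-++ : ∀ {A B : Set} (f : A → List B) xs ys → concatMap f (xs ++ ys) ≡ concatMap f xs ++ concatMap f ys
concatMap-++ f []       ys = refl
concatMap-++ f (x ∷ xs) ys = trans (cong (f x ++_) (concatMap-++ f xs ys)) (sym (++-assoc (f x) _ _))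

concatMap-↭ : ∀ {A B : Set} (f : A → List B) {xs ys} → xs ↭ ys → concatMap f xs ↭ concatMap f ys
concatMap-↭ f Perm.refl           = ↭-refl
concatMap-↭ f (Perm.prep x p)   = ++⁺ˡ (f x) (concatMap-↭ f p)
concatMap-↭ f (Perm.swap x y p) = ↭-trans (shifts (f x) (f y)) (++⁺ˡ (f y) (++⁺ˡ (f x) (concatMap-↭ f p)))
concatMap-↭ f (Perm.trans p q)  = ↭-trans (concatMap-↭ f p) (concatMap-↭ f q)

pairToList : ∀ {A : Set} → A × A → List A
pairToList (a , b) = a ∷ b ∷ []

module _ {A K : Set} (key : A → K) (_≟ₖ_ : DecidableEquality K) where

  pairUpByKey : (xs : List A) → Σ[ P ∈ List A ] Σ[ Q ∈ List (A × A) ]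
                  Unique (map key P) × All (λ ab → key (proj₁ ab) ≡ key (proj₂ ab)) Q × xs ↭ P ++ concatMap pairToList Q
  pairUpByKey []       = [] , [] , [] , [] , ↭-refl
  pairUpByKey (x ∷ xs) with P , Q , uniq , same , xs↭ ← pairUpByKey xs with any? (λ p → key p ≟ₖ key x) P
  ... | no ¬match = x ∷ P , Q , fresh ∷ uniq , same , ↭-prep x xs↭
    where
    fresh : All (key x ≢_) (map key P)
    fresh = All-map⁺ (All.map (λ ¬eq eq → ¬eq (sym eq)) (¬Any⇒All¬ P ¬match))
  ... | yes match with p , p~x , P′ , P↭ ← Any-↭∷ match =
    P′ , (x , p) ∷ Q , drop⁺ 1 (Unique-resp-↭ (↭-map⁺ key P↭) uniq) , sym p~x ∷ same ,
    ↭-trans (↭-prep x (↭-trans xs↭ (++⁺ʳ _ P↭))) (shifts (x ∷ p ∷ []) P′)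

-- Multiset equality up to ≈ (for edges: up to orientation), phrased by counting so that every
-- ≈-invariant statistic, such as a degree or a multiplicity, is preserved.
module CountEquivalence (S : DecSetoid 0ℓ 0ℓ) where

  open DecSetoid S using (_≈_) renaming (Carrier to A; _≟_ to _≈?_; refl to ≈-refl; sym to ≈-sym; trans to ≈-trans)

  infix 4 _≋_
  record _≋_ (xs ys : List A) : Set₁ where
    constructor mk≋
    field counts : ∀ {P : Pred A 0ℓ} (P? : Decidable P) → P Respects _≈_ → count P? xs ≡ count P? ys
  open _≋_ public

  ≋-refl : ∀ {xs} → xs ≋ xs
  ≋-refl = mk≋ λ _ _ → refl

  ≋-sym : ∀ {xs ys} → xs ≋ ys → ys ≋ xs
  ≋-sym p = mk≋ λ P? resp → sym (counts p P? resp)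

  ≋-trans : ∀ {xs ys zs} → xs ≋ ys → ys ≋ zs → xs ≋ zs
  ≋-trans p q = mk≋ λ P? resp → trans (counts p P? resp) (counts q P? resp)

  ≋-reflexive : ∀ {xs ys} → xs ≡ ys → xs ≋ ys
  ≋-reflexive refl = ≋-refl

  ≋-isEquivalence : IsEquivalence _≋_
  ≋-isEquivalence = record { refl = ≋-refl ; sym = ≋-sym ; trans = ≋-trans }

  ≋-setoid : Setoid 0ℓ (Level.suc 0ℓ)
  ≋-setoid = record { isEquivalence = ≋-isEquivalence }

  ≋-++ : ∀ {xs ys us vs} → xs ≋ ys → us ≋ vs → xs ++ us ≋ ys ++ vs
  ≋-++ {xs} {ys} {us} {vs} p q = mk≋ λ P? resp → begin
    count P? (xs ++ us)          ≡⟨ count-++ P? xs us ⟩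
    count P? xs + count P? us    ≡⟨ cong₂ _+_ (counts p P? resp) (counts q P? resp) ⟩
    count P? ys + count P? vs    ≡⟨ count-++ P? ys vs ⟨
    count P? (ys ++ vs)          ∎
    where open ≡-Reasoning

  ↭⇒≋ : ∀ {xs ys} → xs ↭ ys → xs ≋ ys
  ↭⇒≋ xs↭ys = mk≋ λ P? _ → count-↭ P? xs↭ys

  ≈⇒∷≋ : ∀ {x y} xs → x ≈ y → x ∷ xs ≋ y ∷ xs
  ≈⇒∷≋ {x} {y} xs x≈y = mk≋ λ P? resp → ≋-∷ P? resp
    where
    ≋-∷ : ∀ {P : Pred A 0ℓ} (P? : Decidable P) → P Respects _≈_ → count P? (x ∷ xs) ≡ count P? (y ∷ xs)
    ≋-∷ P? resp with P? x | P? y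
    ... | yes _  | yes _  = refl
    ... | no _   | no _   = refl
    ... | yes px | no ¬py = ⊥-elim (¬py (resp x≈y px))
    ... | no ¬px | yes py = ⊥-elim (¬px (resp (≈-sym x≈y) py))

  Pointwise⇒≋ : ∀ {xs ys} → Pointwise _≈_ xs ys → xs ≋ ys
  Pointwise⇒≋ []                        = ≋-refl
  Pointwise⇒≋ (_∷_ {xs = xs} x≈y xs≈ys) = ≋-trans (≈⇒∷≋ xs x≈y) (≋-++ {xs = [ _ ]} ≋-refl (Pointwise⇒≋ xs≈ys))

  ≋-length : ∀ {xs ys} → xs ≋ ys → length xs ≡ length ys
  ≋-length {xs} {ys} p = begin
    length xs              ≡⟨ cong length (filter-all all? (All.universal _ xs)) ⟨
    count all? xs          ≡⟨ counts p all? (λ _ _ → tt) ⟩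
    count all? ys          ≡⟨ cong length (filter-all all? (All.universal _ ys)) ⟩
    length ys              ∎
    where
    open ≡-Reasoning
    all? : Decidable {A = A} (λ _ → ⊤)
    all? _ = yes tt

  All-resp-≋ : ∀ {P : Pred A 0ℓ} → P Respects _≈_ → ∀ {xs ys} → xs ≋ ys → All P xs → All P ys
  All-resp-≋ {P} resp {xs} {ys} p Pxs = All.tabulate λ {y} y∈ →
    let in-ys = Any⇒count-pos (y ≈?_) (lose y∈ ≈-refl)
        in-xs = ≤-trans in-ys (≤-reflexive (sym (counts p (y ≈?_) λ x≈z y≈x → ≈-trans y≈x x≈z)))
        x , x∈ , y≈x = find (count-pos⇒Any (y ≈?_) in-xs)
    in resp (≈-sym y≈x) (All.lookup Pxs x∈)

sameEdge-sym : ∀ {n} {e f : Edge n} → SameEdge e f → SameEdge f e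
sameEdge-sym (inj₁ (refl , refl)) = inj₁ (refl , refl)
sameEdge-sym (inj₂ (refl , refl)) = inj₂ (refl , refl)

sameEdge-trans : ∀ {n} {e f g : Edge n} → SameEdge e f → SameEdge f g → SameEdge e g
sameEdge-trans (inj₁ (refl , refl)) f≈g                  = f≈g
sameEdge-trans (inj₂ (refl , refl)) (inj₁ (refl , refl)) = inj₂ (refl , refl)
sameEdge-trans (inj₂ (refl , refl)) (inj₂ (refl , refl)) = inj₁ (refl , refl)

sameEdge-swap : ∀ {n} (a b : Fin n) → SameEdge (a , b) (b , a)
sameEdge-swap a b = inj₂ (refl , refl)

sameEdge-refl : ∀ {n} {e : Edge n} → SameEdge e e
sameEdge-refl = inj₁ (refl , refl)

edgeDecSetoid : ℕ → DecSetoid 0ℓ 0ℓ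
edgeDecSetoid n = record
  { Carrier          = Edge n
  ; _≈_              = SameEdge
  ; isDecEquivalence = record
    { isEquivalence = record { refl = sameEdge-refl ; sym = sameEdge-sym ; trans = sameEdge-trans }
    ; _≟_           = sameEdge?
    }
  }

module _ {n : ℕ} where

  open CountEquivalence (edgeDecSetoid n)

  NonLoop : Edge n → Set
  NonLoop (a , b) = a ≢ b

  Loopless : List (Edge n) → Set
  Loopless = All NonLoop

  nonLoop-resp : NonLoop Respects SameEdge
  nonLoop-resp (inj₁ (refl , refl)) a≢b = a≢b
  nonLoop-resp (inj₂ (refl , refl)) a≢b = a≢b ∘ sym

  incident-resp : ∀ (v : Fin n) → Incident v Respects SameEdge
  incident-resp v (inj₁ (refl , refl)) inc        = inc
  incident-resp v (inj₂ (refl , refl)) (inj₁ a≡v) = inj₂ a≡v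
  incident-resp v (inj₂ (refl , refl)) (inj₂ b≡v) = inj₁ b≡v

  incident-orient : ∀ {v : Fin n} e → Incident v e → ∃ λ u → SameEdge e (v , u)
  incident-orient (a , b) (inj₁ refl) = b , inj₁ (refl , refl)
  incident-orient (a , b) (inj₂ refl) = a , inj₂ (refl , refl)

  deg : Fin n → List (Edge n) → ℕ
  deg v = count (incident? v)

  Even : List (Edge n) → Set
  Even L = ∀ v → 2 ∣ deg v L

  Even-resp-≋ : ∀ {L M} → L ≋ M → Even L → Even M
  Even-resp-≋ L≋M even v = subst (2 ∣_) (counts L≋M (incident? v) (incident-resp v)) (even v)

  Even-++ : ∀ {L M} → Even L → Even M → Even (L ++ M)
  Even-++ {L} {M} evenL evenM v = subst (2 ∣_) (sym (count-++ (incident? v) L M)) (∣m∣n⇒∣m+n (evenL v) (evenM v))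

  Even-cancelˡ : ∀ {L M} → Even L → Even (L ++ M) → Even M
  Even-cancelˡ {L} {M} evenL even v = ∣m+n∣m⇒∣n (subst (2 ∣_) (count-++ (incident? v) L M) (even v)) (evenL v)

  Even-Loopless-cancelˡ : ∀ A {B L} → A ++ B ≋ L → Even L → Loopless L → (Loopless A → Even A) → Even B × Loopless B
  Even-Loopless-cancelˡ A A++B≋L even loopless even-A =
    Even-cancelˡ {A} (even-A (++⁻ˡ A loopless-A++B)) (Even-resp-≋ (≋-sym A++B≋L) even) , ++⁻ʳ A loopless-A++B
    where
    loopless-A++B = All-resp-≋ nonLoop-resp (≋-sym A++B≋L) loopless

  occurrences : Fin n → List (Fin n) → ℕ
  occurrences v = count (_≟ᶠ v)

  pathEdges : List (Fin n) → List (Edge n)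
  pathEdges (a ∷ b ∷ vs) = (a , b) ∷ pathEdges (b ∷ vs)
  pathEdges _            = []

  deg-edge : ∀ v {a b} → a ≢ b → deg v [ a , b ] ≡ occurrences v [ a ] + occurrences v [ b ]
  deg-edge v {a} {b} a≢b with a ≟ᶠ v | b ≟ᶠ v
  ... | yes refl | yes refl = ⊥-elim (a≢b refl)
  ... | yes _    | no _     = refl
  ... | no _     | yes _    = refl
  ... | no _     | no _     = refl

  deg-path : ∀ v x ys z → Loopless (pathEdges (x ∷ ys ++ [ z ])) →
             deg v (pathEdges (x ∷ ys ++ [ z ])) ≡ occurrences v [ x ] + occurrences v [ z ] + 2 * occurrences v ys
  deg-path v x []       z (x≢z ∷ []) = trans (deg-edge v x≢z) (sym (+-identityʳ _))
  deg-path v x (y ∷ ys) z (x≢y ∷ loopless) = begin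
    deg v (pathEdges (x ∷ y ∷ ys ++ [ z ]))
      ≡⟨ count-++ (incident? v) [ x , y ] (pathEdges (y ∷ ys ++ [ z ])) ⟩
    deg v [ x , y ] + deg v (pathEdges (y ∷ ys ++ [ z ]))
      ≡⟨ cong₂ _+_ (deg-edge v x≢y) (deg-path v y ys z loopless) ⟩
    occurrences v [ x ] + occurrences v [ y ] + (occurrences v [ y ] + occurrences v [ z ] + 2 * occurrences v ys)
      ≡⟨ rearrange (occurrences v [ x ]) (occurrences v [ y ]) (occurrences v [ z ]) (occurrences v ys) ⟩
    occurrences v [ x ] + occurrences v [ z ] + 2 * (occurrences v [ y ] + occurrences v ys)
      ≡⟨ cong (λ k → occurrences v [ x ] + occurrences v [ z ] + 2 * k) (count-++ (_≟ᶠ v) [ y ] ys) ⟨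
    occurrences v [ x ] + occurrences v [ z ] + 2 * occurrences v (y ∷ ys) ∎
    where
    open ≡-Reasoning
    rearrange : ∀ a b c d → a + b + (b + c + 2 * d) ≡ a + c + 2 * (b + d)
    rearrange = solve-∀

  closedWalk-even : ∀ x ys → Loopless (pathEdges (x ∷ ys ++ [ x ])) → Even (pathEdges (x ∷ ys ++ [ x ]))
  closedWalk-even x ys loopless v = divides (occurrences v [ x ] + occurrences v ys)
    (trans (deg-path v x ys x loopless) (double (occurrences v [ x ]) (occurrences v ys)))
    where
    double : ∀ a b → a + a + 2 * b ≡ (a + b) * 2
    double = solve-∀

  pathEdges-split : ∀ x ys z zs → pathEdges (x ∷ ys ++ z ∷ zs) ≡ pathEdges (x ∷ ys ++ [ z ]) ++ pathEdges (z ∷ zs)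
  pathEdges-split x []       z zs = refl
  pathEdges-split x (y ∷ ys) z zs = cong ((x , y) ∷_) (pathEdges-split y ys z zs)

  length-pathEdges : ∀ x ys z → length (pathEdges (x ∷ ys ++ [ z ])) ≡ suc (length ys)
  length-pathEdges x []       z = refl
  length-pathEdges x (y ∷ ys) z = cong suc (length-pathEdges y ys z)

  pathEdges-∉ : ∀ {v vs} → v ∉ vs → All (∁ (Incident v)) (pathEdges vs)
  pathEdges-∉ {vs = []}        _  = []
  pathEdges-∉ {vs = _ ∷ []}    _  = []
  pathEdges-∉ {vs = _ ∷ _ ∷ _} v∉ = (λ { (inj₁ refl) → v∉ (here refl) ; (inj₂ refl) → v∉ (there (here refl)) })
                                    ∷ pathEdges-∉ (v∉ ∘ there)

  deg-path-end : ∀ {v u r} → v ∉ u ∷ r → deg v (pathEdges (v ∷ u ∷ r)) ≡ 1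
  deg-path-end {v} {u} {r} v∉ = begin
    deg v (pathEdges (v ∷ u ∷ r))               ≡⟨ count-accept (incident? v) (pathEdges (u ∷ r)) (inj₁ refl) ⟩
    suc (deg v (pathEdges (u ∷ r)))             ≡⟨ cong suc (count-none (incident? v) (pathEdges-∉ v∉)) ⟩
    1                                           ∎
    where open ≡-Reasoning

  walkVertex : Fin n → (ys : List (Fin n)) → Fin n → Fin (suc (suc (length ys))) → Fin n
  walkVertex x ys       z zero          = x
  walkVertex x []       z (suc zero)    = z
  walkVertex x (y ∷ ys) z (suc i)       = walkVertex y ys z i

  walkVertex-last : ∀ x ys z → walkVertex x ys z (fromℕ (suc (length ys))) ≡ z
  walkVertex-last x []       z = refl
  walkVertex-last x (y ∷ ys) z = walkVertex-last y ys z

  walkVertex-inject₁ : ∀ x ys z i → walkVertex x ys z (inject₁ i) ≡ lookup (x ∷ ys) i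
  walkVertex-inject₁ x ys       z zero    = refl
  walkVertex-inject₁ x (y ∷ ys) z (suc i) = walkVertex-inject₁ y ys z i

  tabulate-walkVertex : ∀ x ys z →
    tabulate (λ i → walkVertex x ys z (inject₁ i) , walkVertex x ys z (suc i)) ≡ pathEdges (x ∷ ys ++ [ z ])
  tabulate-walkVertex x []       z = refl
  tabulate-walkVertex x (y ∷ ys) z = cong ((x , y) ∷_) (tabulate-walkVertex y ys z)

  closedWalk : Fin n → List (Fin n) → Cycle n
  closedWalk x ys = record
    { len    = suc (length ys)
    ; vtx    = walkVertex x ys x
    ; closed = sym (walkVertex-last x ys x)
    }

  cycleEdges-closedWalk : ∀ x ys → cycleEdges (closedWalk x ys) ≡ pathEdges (x ∷ ys ++ [ x ])
  cycleEdges-closedWalk x ys = trans (map-tabulate (λ i → i) (cycleEdge (closedWalk x ys))) (tabulate-walkVertex x ys x)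

  closedWalk-simple : ∀ {x ys} → Unique (x ∷ ys) → IsSimple (closedWalk x ys)
  closedWalk-simple {x} {ys} uniq i j i≢j eq = i≢j (Unique-lookup-injective uniq (begin
    lookup (x ∷ ys) i               ≡⟨ walkVertex-inject₁ x ys x i ⟨
    walkVertex x ys x (inject₁ i)   ≡⟨ eq ⟩
    walkVertex x ys x (inject₁ j)   ≡⟨ walkVertex-inject₁ x ys x j ⟩
    lookup (x ∷ ys) j               ∎))
    where open ≡-Reasoning

  All-IsCycleIn : ∀ (G : Multigraph n) Cs → concatMap cycleEdges Cs ≋ edges G → All (IsCycleIn G) Cs
  All-IsCycleIn G Cs Cs≋G = All.map (λ inG i → All.lookup (All-map⁻ inG) (∈-allFin i)) (All-map⁻ (concat⁻ in-G))
    where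
    ∈E-resp : (_∈E G) Respects SameEdge
    ∈E-resp e≈f = Any.map (sameEdge-trans (sameEdge-sym e≈f))

    in-G : All (_∈E G) (concatMap cycleEdges Cs)
    in-G = All-resp-≋ ∈E-resp (≋-sym Cs≋G) (All.tabulate (λ e∈ → lose e∈ sameEdge-refl))

-- Splitting an even loopless edge list into simple circuits

module _ {n : ℕ} where

  open CountEquivalence (edgeDecSetoid n)
  odd-remainder : ∀ {v : Fin n} (A : List (Edge n)) {B} → 2 ∣ deg v (A ++ B) → deg v A ≡ 1 → 0 < deg v B
  odd-remainder {v} A {B} even degA =
    2∣suc⇒pos (subst (2 ∣_) (trans (count-++ (incident? v) A B) (cong (_+ deg v B) degA)) even)

  remove-incident : ∀ {v : Fin n} {R} → 0 < deg v R → ∃₂ λ w R′ → R ≋ (w , v) ∷ R′ × length R ≡ suc (length R′)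
  remove-incident {v} pos with f , f-inc , R′ , R↭ ← Any-↭∷ (count-pos⇒Any (incident? v) pos)
                          with w , f≈vw ← incident-orient f f-inc =
    w , R′ , ≋-trans (↭⇒≋ R↭) (≈⇒∷≋ R′ (sameEdge-trans f≈vw (sameEdge-swap v w))) , ↭-length R↭

  open DecMembership (_≟ᶠ_ {n}) using (_∈?_)

  record Circuit : Set where
    constructor circuit
    field
      start next : Fin n
      rest       : List (Fin n)
      distinct   : Unique (start ∷ next ∷ rest)

  circuitEdges : Circuit → List (Edge n)
  circuitEdges (circuit s t r _) = pathEdges (s ∷ (t ∷ r) ++ [ s ])

  circuitCycle : Circuit → Cycle n
  circuitCycle (circuit s t r _) = closedWalk s (t ∷ r)

  module _ {L : List (Edge n)} (even : Even L) (loopless : Loopless L) where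

    CircuitSplit : Set₁
    CircuitSplit = Σ[ c ∈ Circuit ] Σ[ L′ ∈ List (Edge n) ] circuitEdges c ++ L′ ≋ L

    -- Walk from the head v of a simple path: v has odd degree in the unused edges,
    -- so the walk can always continue, and it closes a circuit on its first return.
    growPath : ∀ v u r R → Unique (v ∷ u ∷ r) → pathEdges (v ∷ u ∷ r) ++ R ≋ L → Acc _<_ (length R) → CircuitSplit
    growPath v u r R uniq path≋ (acc rec)
      with w , R′ , R≋ , length-R ← remove-incident
             (odd-remainder (pathEdges (v ∷ u ∷ r)) (Even-resp-≋ (≋-sym path≋) even v)
                            (deg-path-end (Unique[x∷xs]⇒x∉xs uniq)))
      = continue (w ∈? (u ∷ r))
      where
      path = pathEdges (v ∷ u ∷ r)

      path′≋ : (w , v) ∷ path ++ R′ ≋ L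
      path′≋ = begin
        (w , v) ∷ path ++ R′   ≈⟨ ↭⇒≋ (shift (w , v) path R′) ⟨
        path ++ (w , v) ∷ R′   ≈⟨ ≋-++ {xs = path} ≋-refl R≋ ⟨
        path ++ R              ≈⟨ path≋ ⟩
        L                      ∎
        where open SetoidReasoning ≋-setoid

      w≢v : w ≢ v
      w≢v = All.head (All-resp-≋ nonLoop-resp (≋-sym path′≋) loopless)

      continue : Dec (w ∈ u ∷ r) → CircuitSplit
      continue (no w∉) =
        growPath w v (u ∷ r) R′ ((w≢v ∷ ¬Any⇒All¬ _ w∉) ∷ uniq) path′≋ (rec (≤-reflexive (sym length-R)))
      continue (yes w∈) with fr , bk , u∷r≡ ← ∈-∃++ w∈ =
        circuit w v fr distinct , pathEdges (w ∷ bk) ++ R′ , ≋-trans (≋-reflexive edges≡) path′≋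
        where
        split : v ∷ u ∷ r ≡ (v ∷ fr) ++ w ∷ bk
        split = cong (v ∷_) u∷r≡

        distinct : Unique (w ∷ v ∷ fr)
        distinct = Unique-++⁻ˡ (w ∷ v ∷ fr) (Unique-resp-↭ (shift w (v ∷ fr) bk) (subst Unique split uniq))

        edges≡ : ((w , v) ∷ pathEdges (v ∷ fr ++ [ w ])) ++ pathEdges (w ∷ bk) ++ R′ ≡ (w , v) ∷ path ++ R′
        edges≡ = cong ((w , v) ∷_) (begin
          pathEdges (v ∷ fr ++ [ w ]) ++ pathEdges (w ∷ bk) ++ R′    ≡⟨ ++-assoc (pathEdges (v ∷ fr ++ [ w ])) _ R′ ⟨
          (pathEdges (v ∷ fr ++ [ w ]) ++ pathEdges (w ∷ bk)) ++ R′  ≡⟨ cong (_++ R′) (pathEdges-split v fr w bk) ⟨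
          pathEdges (v ∷ fr ++ w ∷ bk) ++ R′                         ≡⟨ cong (λ vs → pathEdges vs ++ R′) split ⟨
          path ++ R′                                                 ∎)
          where open ≡-Reasoning

    findCircuit : ∀ {e L₀} → L ≡ e ∷ L₀ → CircuitSplit
    findCircuit {a , b} {L₀} refl =
      growPath b a [] L₀ (((a≢b ∘ sym) ∷ []) ∷ [] ∷ []) (≈⇒∷≋ L₀ (sameEdge-swap b a)) (<-wellFounded (length L₀))
      where
      a≢b : a ≢ b
      a≢b = All.head loopless

  circuitCycle-edges : ∀ c → cycleEdges (circuitCycle c) ≡ circuitEdges c
  circuitCycle-edges (circuit s t r _) = cycleEdges-closedWalk s (t ∷ r)

  circuitCycle-simple : ∀ c → IsSimple (circuitCycle c)
  circuitCycle-simple (circuit _ _ _ distinct) = closedWalk-simple distinct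

  circuit-length : ∀ c → length (circuitEdges c) ≡ suc (suc (length (Circuit.rest c)))
  circuit-length (circuit s t r _) = length-pathEdges s (t ∷ r) s

  circuit-loopless⇒even : ∀ c → Loopless (circuitEdges c) → Even (circuitEdges c)
  circuit-loopless⇒even (circuit s t r _) = closedWalk-even s (t ∷ r)

  circuit-split-shorter : ∀ c {L L′} → circuitEdges c ++ L′ ≋ L → 2 + length L′ ≤ length L
  circuit-split-shorter c {L} {L′} split = begin
    2 + length L′                                        ≤⟨ +-monoˡ-≤ (length L′) (s≤s (s≤s z≤n)) ⟩
    suc (suc (length (Circuit.rest c))) + length L′      ≡⟨ cong (_+ length L′) (circuit-length c) ⟨
    length (circuitEdges c) + length L′                  ≡⟨ length-++ (circuitEdges c) ⟨
    length (circuitEdges c ++ L′)                        ≡⟨ ≋-length split ⟩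
    length L                                             ∎
    where open ≤-Reasoning

  circuitDecomposition : ∀ L → Even L → Loopless L → Acc _<_ (length L) →
              Σ[ S ∈ List Circuit ] concatMap circuitEdges S ≋ L × 2 * length S ≤ length L
  circuitDecomposition []        _    _        _         = [] , ≋-refl , z≤n
  circuitDecomposition L@(_ ∷ _) even loopless (acc rec)
    with c , L′ , split ← findCircuit even loopless refl
    with even′ , loopless′ ← Even-Loopless-cancelˡ (circuitEdges c) split even loopless (circuit-loopless⇒even c)
    with S , S≋ , S-bound ← circuitDecomposition L′ even′ loopless′
                               (rec (≤-trans (n≤1+n _) (circuit-split-shorter c split)))
    = c ∷ S , ≋-trans (≋-++ {xs = circuitEdges c} ≋-refl S≋) split , bound
    where
    bound : 2 * suc (length S) ≤ length L
    bound = begin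
      2 * suc (length S)     ≡⟨ *-suc 2 (length S) ⟩
      2 + 2 * length S       ≤⟨ +-monoʳ-≤ 2 S-bound ⟩
      2 + length L′          ≤⟨ circuit-split-shorter c split ⟩
      length L               ∎
      where open ≤-Reasoning

module _ {n : ℕ} where

  open CountEquivalence (edgeDecSetoid n)
  open DecMembership (≡-dec (_≟ᶠ_ {n}) (_≟ᶠ_ {n})) using () renaming (_∈?_ to _∈ₑ?_)

  sameAs-resp : ∀ (f : Edge n) → (λ e → SameEdge e f) Respects SameEdge
  sameAs-resp f e≈e′ e≈f = sameEdge-trans (sameEdge-sym e≈e′) e≈f

  mult-resp-≋ : ∀ {L M} → L ≋ M → ∀ u v → mult L u v ≡ mult M u v
  mult-resp-≋ L≋M u v = counts L≋M (λ e → sameEdge? e (u , v)) (sameAs-resp (u , v))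

  -- With every unordered edge occurring at most twice, the copies of an
  -- edge can be oriented in opposite directions, leaving no repeated pair.
  orientDistinct : ∀ L → Loopless L → (∀ u v → mult L u v ≤ 2) → Σ[ O ∈ List (Edge n) ] O ≋ L × Unique O
  orientDistinct []             _                  _      = [] , ≋-refl , []
  orientDistinct ((a , b) ∷ L) (a≢b ∷ loopless) mult≤2
    with O , O≋ , uniq ← orientDistinct L loopless (λ u v → ≤-trans (count-≤-++ʳ _ [ a , b ] L) (mult≤2 u v))
    with (a , b) ∈ₑ? O | (b , a) ∈ₑ? O
  ... | no ab∉  | _       = (a , b) ∷ O , ≋-++ {xs = [ a , b ]} ≋-refl O≋ , ¬Any⇒All¬ O ab∉ ∷ uniq
  ... | yes _   | no ba∉  = (b , a) ∷ O , ≋-trans (≈⇒∷≋ O (sameEdge-swap b a)) (≋-++ {xs = [ a , b ]} ≋-refl O≋) ,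
                            ¬Any⇒All¬ O ba∉ ∷ uniq
  ... | yes ab∈ | yes ba∈ = ⊥-elim (≤⇒≯ (mult≤2 a b) three-copies)
    where
    open ≤-Reasoning
    three-copies : 2 < mult ((a , b) ∷ L) a b
    three-copies = begin-strict
      2                        ≤⟨ distinct-members⇒2≤count (λ e → sameEdge? e (a , b)) (a≢b ∘ cong proj₁)
                                    ab∈ ba∈ sameEdge-refl (sameEdge-swap b a) ⟩
      mult O a b               ≡⟨ mult-resp-≋ O≋ a b ⟩
      mult L a b               <⟨ ≤-refl ⟩
      suc (mult L a b)         ≡⟨ count-accept (λ e → sameEdge? e (a , b)) L sameEdge-refl ⟨
      mult ((a , b) ∷ L) a b   ∎

-- Cherries through the vertices outside a vertex cover

module _ {n : ℕ} (VC : Subset n) where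

  open CountEquivalence (edgeDecSetoid n)

  Covered Inner Outer : Edge n → Set
  Covered (a , b) = a ∈ₛ VC ⊎ b ∈ₛ VC
  Inner   (a , b) = a ∈ₛ VC × b ∈ₛ VC
  Outer   (a , b) = a ∉ₛ VC ⊎ b ∉ₛ VC

  outer? : Decidable Outer
  outer? (a , b) = ¬? (a ∈ₛ? VC) ⊎-dec ¬? (b ∈ₛ? VC)

  ¬outer⇒inner : ∀ {e} → ¬ Outer e → Inner e
  ¬outer⇒inner {a , b} ¬outer = decidable-stable (a ∈ₛ? VC) (¬outer ∘ inj₁) , decidable-stable (b ∈ₛ? VC) (¬outer ∘ inj₂)

  covered-resp : Covered Respects SameEdge
  covered-resp (inj₁ (refl , refl)) cov         = cov
  covered-resp (inj₂ (refl , refl)) (inj₁ a∈) = inj₂ a∈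
  covered-resp (inj₂ (refl , refl)) (inj₂ b∈) = inj₁ b∈

  inner-resp : Inner Respects SameEdge
  inner-resp (inj₁ (refl , refl)) inner     = inner
  inner-resp (inj₂ (refl , refl)) (a∈ , b∈) = b∈ , a∈

  outer-orient : ∀ {e} → Covered e → Outer e → ∃₂ λ x w → SameEdge e (x , w) × x ∈ₛ VC × w ∉ₛ VC
  outer-orient {a , b} (inj₁ a∈) (inj₁ a∉) = ⊥-elim (a∉ a∈)
  outer-orient {a , b} (inj₁ a∈) (inj₂ b∉) = a , b , sameEdge-refl , a∈ , b∉
  outer-orient {a , b} (inj₂ b∈) (inj₁ a∉) = b , a , sameEdge-swap a b , b∈ , a∉
  outer-orient {a , b} (inj₂ b∈) (inj₂ b∉) = ⊥-elim (b∉ b∈)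

  ∈∉⇒≢ : ∀ {a b} → a ∈ₛ VC → b ∉ₛ VC → a ≢ b
  ∈∉⇒≢ a∈ b∉ refl = b∉ a∈

  record Cherry : Set where
    constructor cherry
    field
      left middle right : Fin n
      left∈   : left ∈ₛ VC
      middle∉ : middle ∉ₛ VC
      right∈  : right ∈ₛ VC

  cherryEdges : Cherry → List (Edge n)
  cherryEdges (cherry l m r _ _ _) = pathEdges (l ∷ m ∷ r ∷ [])

  ends : Cherry → Fin n × Fin n
  ends c = Cherry.left c , Cherry.right c

  cherry-even-outside : ∀ c {v} → v ∉ₛ VC → 2 ∣ deg v (cherryEdges c)
  cherry-even-outside (cherry l m r l∈ m∉ r∈) {v} v∉ =
    subst (2 ∣_) (sym deg≡) (m∣m*n (occurrences v [ m ]))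
    where
    deg≡ : deg v (cherryEdges (cherry l m r l∈ m∉ r∈)) ≡ 2 * occurrences v [ m ]
    deg≡ = begin
      deg v (pathEdges (l ∷ [ m ] ++ [ r ]))
        ≡⟨ deg-path v l [ m ] r (∈∉⇒≢ l∈ m∉ ∷ (∈∉⇒≢ r∈ m∉ ∘ sym) ∷ []) ⟩
      occurrences v [ l ] + occurrences v [ r ] + 2 * occurrences v [ m ]
        ≡⟨ cong₂ (λ a b → a + b + 2 * occurrences v [ m ])
             (count-none (_≟ᶠ v) (∈∉⇒≢ l∈ v∉ ∷ [])) (count-none (_≟ᶠ v) (∈∉⇒≢ r∈ v∉ ∷ [])) ⟩
      2 * occurrences v [ m ] ∎
      where open ≡-Reasoning

  quad : Cherry × Cherry → Cycle n
  quad (cherry l m r _ _ _ , cherry _ m′ _ _ _ _) = closedWalk l (m ∷ r ∷ m′ ∷ [])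

  quadEdges : List (Cherry × Cherry) → List (Edge n)
  quadEdges = concatMap (cycleEdges ∘ quad)

  quad-even : ∀ cd → Even (cycleEdges (quad cd))
  quad-even (cherry l m r l∈ m∉ r∈ , cherry _ m′ _ _ m′∉ _) =
    subst Even (sym (cycleEdges-closedWalk l (m ∷ r ∷ m′ ∷ [])))
      (closedWalk-even l (m ∷ r ∷ m′ ∷ [])
        (∈∉⇒≢ l∈ m∉ ∷ (∈∉⇒≢ r∈ m∉ ∘ sym) ∷ ∈∉⇒≢ r∈ m′∉ ∷ (∈∉⇒≢ l∈ m′∉ ∘ sym) ∷ []))

  quad-edges : ∀ c d → ends c ≡ ends d → cherryEdges c ++ cherryEdges d ≋ cycleEdges (quad (c , d))
  quad-edges c@(cherry l m r _ _ _) d@(cherry .l m′ .r _ _ _) refl = begin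
    (l , m) ∷ (m , r) ∷ (l , m′) ∷ (m′ , r) ∷ []   ≈⟨ ↭⇒≋ (↭-prep _ (↭-prep _ (↭-swap _ _ ↭-refl))) ⟩
    (l , m) ∷ (m , r) ∷ (m′ , r) ∷ (l , m′) ∷ []   ≈⟨ Pointwise⇒≋ (sameEdge-refl ∷ sameEdge-refl ∷
                                                                    sameEdge-swap m′ r ∷ sameEdge-swap l m′ ∷ []) ⟩
    (l , m) ∷ (m , r) ∷ (r , m′) ∷ (m′ , l) ∷ []   ≡⟨ cycleEdges-closedWalk l (m ∷ r ∷ m′ ∷ []) ⟨
    cycleEdges (quad (c , d))                        ∎
    where open SetoidReasoning ≋-setoid

  OuterEven : List (Edge n) → Set
  OuterEven L = ∀ v → v ∉ₛ VC → 2 ∣ deg v L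

  pluckCherry : ∀ {L} → All Covered L → OuterEven L → Any Outer L →
                Σ[ c ∈ Cherry ] Σ[ L′ ∈ List (Edge n) ] L ≋ cherryEdges c ++ L′
  pluckCherry {L} covered even outer
    with e , e-outer , L₁ , L↭ ← Any-↭∷ outer
    with e-covered ∷ covered₁ ← All-resp-↭ L↭ covered
    with x , w , e≈xw , x∈ , w∉ ← outer-orient e-covered e-outer
    with y , L₂ , L₁≋ , _ ← remove-incident (odd-remainder [ e ]
           (subst (2 ∣_) (count-↭ (incident? w) L↭) (even w w∉))
           (count-accept (incident? w) [] (incident-resp w (sameEdge-sym e≈xw) (inj₂ refl))))
    with yw-covered ∷ _ ← All-resp-≋ covered-resp L₁≋ covered₁
    = cherry x w y x∈ w∉ (y∈ yw-covered) , L₂ , L≋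
    where
    y∈ : Covered (y , w) → y ∈ₛ VC
    y∈ (inj₁ y∈) = y∈
    y∈ (inj₂ w∈) = ⊥-elim (w∉ w∈)

    L≋ : L ≋ (x , w) ∷ (w , y) ∷ L₂
    L≋ = begin
      L                        ≈⟨ ↭⇒≋ L↭ ⟩
      e ∷ L₁                   ≈⟨ ≈⇒∷≋ L₁ e≈xw ⟩
      (x , w) ∷ L₁             ≈⟨ ≋-++ {xs = [ x , w ]} ≋-refl L₁≋ ⟩
      (x , w) ∷ (y , w) ∷ L₂   ≈⟨ ≋-++ {xs = [ x , w ]} ≋-refl (≈⇒∷≋ L₂ (sameEdge-swap y w)) ⟩
      (x , w) ∷ (w , y) ∷ L₂   ∎
      where open SetoidReasoning ≋-setoid

  cherry-remainder : ∀ c {L L′} → L ≋ cherryEdges c ++ L′ → All Covered L → OuterEven L →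
                     All Covered L′ × OuterEven L′ × length L′ < length L
  cherry-remainder c@(cherry _ _ _ _ _ _) {L} {L′} L≋ covered even =
    ++⁻ʳ (cherryEdges c) (All-resp-≋ covered-resp L≋ covered) , even′ ,
    ≤-trans (n≤1+n _) (≤-reflexive (sym (≋-length L≋)))
    where
    even′ : OuterEven L′
    even′ v v∉ = ∣m+n∣m⇒∣n (subst (2 ∣_) deg≡ (even v v∉)) (cherry-even-outside c v∉)
      where
      deg≡ : deg v L ≡ deg v (cherryEdges c) + deg v L′
      deg≡ = trans (counts L≋ (incident? v) (incident-resp v)) (count-++ (incident? v) (cherryEdges c) L′)

  formCherries : ∀ L → All Covered L → OuterEven L → Acc _<_ (length L) →
                 Σ[ R ∈ List (Edge n) ] Σ[ Ch ∈ List Cherry ] All Inner R × L ≋ R ++ concatMap cherryEdges Ch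
  formCherries L covered even (acc rec) with any? outer? L
  ... | no ¬outer = L , [] , All.map ¬outer⇒inner (¬Any⇒All¬ L ¬outer) , ≋-reflexive (sym (++-identityʳ L))
  ... | yes outer
    with c , L′ , L≋ ← pluckCherry covered even outer
    with covered′ , even′ , shorter ← cherry-remainder c L≋ covered even
    with R , Ch , inner , L′≋ ← formCherries L′ covered′ even′ (rec shorter)
    = R , c ∷ Ch , inner , ≋-trans L≋ (≋-trans (≋-++ {xs = cherryEdges c} ≋-refl L′≋) (↭⇒≋ (shifts (cherryEdges c) R)))

  quad-len : ∀ cd → len (quad cd) ≡ 4
  quad-len (cherry _ _ _ _ _ _ , cherry _ _ _ _ _ _) = refl

  paired-quads : ∀ {Q} → All (λ cd → ends (proj₁ cd) ≡ ends (proj₂ cd)) Q →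
                 concatMap cherryEdges (concatMap pairToList Q) ≋ quadEdges Q
  paired-quads []                        = ≋-refl
  paired-quads {(c , d) ∷ Q} (same ∷ sames) =
    ≋-trans (≋-reflexive (sym (++-assoc (cherryEdges c) (cherryEdges d) _))) (≋-++ (quad-edges c d same) (paired-quads sames))

  cherrySplit : ∀ (G : Multigraph n) → IsVertexCover G VC → Even (edges G) →
    Σ[ R ∈ List (Edge n) ] Σ[ P ∈ List Cherry ] Σ[ Q ∈ List (Cherry × Cherry) ]
      All Inner R × Unique (map ends P) × quadEdges Q ++ (R ++ concatMap cherryEdges P) ≋ edges G
  cherrySplit G cover even
    with R , Ch , inner , G≋ ← formCherries (edges G) cover (λ v _ → even v) (<-wellFounded _)
    with P , Q , ends-unique , sames , Ch↭ ← pairUpByKey ends (≡-dec _≟ᶠ_ _≟ᶠ_) Ch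
    = R , P , Q , inner , ends-unique , (begin
      quads ++ R ++ cherries P              ≈⟨ ↭⇒≋ (shifts quads R) ⟩
      R ++ quads ++ cherries P              ≈⟨ ≋-++ {xs = R} ≋-refl (↭⇒≋ (++-comm quads (cherries P))) ⟩
      R ++ cherries P ++ quads              ≈⟨ ≋-++ {xs = R} ≋-refl (≋-++ {xs = cherries P} ≋-refl (paired-quads sames)) ⟨
      R ++ cherries P ++ cherries (concatMap pairToList Q)
                                            ≡⟨ cong (R ++_) (concatMap-++ cherryEdges P _) ⟨
      R ++ cherries (P ++ concatMap pairToList Q)
                                            ≈⟨ ≋-++ {xs = R} ≋-refl (↭⇒≋ (concatMap-↭ cherryEdges Ch↭)) ⟨
      R ++ cherries Ch                      ≈⟨ G≋ ⟨
      edges G                               ∎)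
    where
    open SetoidReasoning ≋-setoid
    cherries = concatMap cherryEdges
    quads    = quadEdges Q

  pairs-bound : ∀ {ps} → Unique ps → All Inner ps → length ps ≤ ∣ VC ∣ * ∣ VC ∣
  pairs-bound {ps} uniq inner = begin
    length ps                                   ≤⟨ Unique⊆⇒length≤ uniq (All.map inner⇒∈ inner) ⟩
    length (cartesianProduct ms ms)   ≡⟨ length-cartesianProduct ms ms ⟩
    length ms * length ms           ≡⟨ cong₂ _*_ (length-members VC) (length-members VC) ⟩
    ∣ VC ∣ * ∣ VC ∣                             ∎
    where
    open ≤-Reasoning
    ms = members VC
    inner⇒∈ : ∀ {e} → Inner e → e ∈ cartesianProduct ms ms
    inner⇒∈ (a∈ , b∈) = ∈-cartesianProduct⁺ (∈-members a∈) (∈-members b∈)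

  inner-edges-bound : ∀ {R} → Loopless R → All Inner R → (∀ u v → mult R u v ≤ 2) → length R ≤ ∣ VC ∣ * ∣ VC ∣
  inner-edges-bound {R} loopless inner mult≤2 with O , O≋ , uniq ← orientDistinct R loopless mult≤2 =
    subst (_≤ ∣ VC ∣ * ∣ VC ∣) (≋-length O≋) (pairs-bound uniq (All-resp-≋ inner-resp (≋-sym O≋) inner))

  cherries-bound : ∀ {P} → Unique (map ends P) → length P ≤ ∣ VC ∣ * ∣ VC ∣
  cherries-bound {P} uniq =
    subst (_≤ ∣ VC ∣ * ∣ VC ∣) (length-map ends P) (pairs-bound uniq (All-map⁺ (All.universal ends-inner P)))
    where
    ends-inner : ∀ c → Inner (ends c)
    ends-inner (cherry _ _ _ l∈ _ r∈) = l∈ , r∈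

  length-cherryEdges : ∀ P → length (concatMap cherryEdges P) ≡ 2 * length P
  length-cherryEdges []                           = refl
  length-cherryEdges (cherry _ _ _ _ _ _ ∷ P) = trans (cong (2 +_) (length-cherryEdges P)) (sym (*-suc 2 (length P)))

  quads-even : ∀ Q → Even (quadEdges Q)
  quads-even []       v = 2 ∣0
  quads-even (cd ∷ Q)   = Even-++ {L = cycleEdges (quad cd)} (quad-even cd) (quads-even Q)

  family-edges : ∀ Q S → concatMap cycleEdges (map quad Q ++ map circuitCycle S)
                         ≡ quadEdges Q ++ concatMap circuitEdges S
  family-edges Q S = begin
    concatMap cycleEdges (map quad Q ++ map circuitCycle S)
      ≡⟨ concatMap-++ cycleEdges (map quad Q) (map circuitCycle S) ⟩
    concat (map cycleEdges (map quad Q)) ++ concat (map cycleEdges (map circuitCycle S))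
      ≡⟨ cong₂ (λ xs ys → concat xs ++ concat ys) (map-∘ Q) (trans (sym (map-cong circuitCycle-edges S)) (map-∘ S)) ⟨
    quadEdges Q ++ concatMap circuitEdges S ∎
    where open ≡-Reasoning

  family-nonfour : ∀ Q S → length (filter (λ C → ¬? (len C ≟ 4)) (map quad Q ++ map circuitCycle S)) ≤ length S
  family-nonfour Q S = begin
    length (filter nonfour? (map quad Q ++ map circuitCycle S))
      ≡⟨ cong length (filter-++ nonfour? (map quad Q) (map circuitCycle S)) ⟩
    length (filter nonfour? (map quad Q) ++ filter nonfour? (map circuitCycle S))
      ≡⟨ cong (λ xs → length (xs ++ filter nonfour? (map circuitCycle S))) (filter-none nonfour? quads-four) ⟩
    length (filter nonfour? (map circuitCycle S))   ≤⟨ length-filter nonfour? (map circuitCycle S) ⟩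
    length (map circuitCycle S)                     ≡⟨ length-map circuitCycle S ⟩
    length S                                        ∎
    where
    open ≤-Reasoning
    nonfour? = λ (C : Cycle n) → ¬? (len C ≟ 4)
    quads-four : All (λ C → ¬ ¬ len C ≡ 4) (map quad Q)
    quads-four = All-map⁺ (All.universal (λ cd len≢4 → len≢4 (quad-len cd)) Q)

  family-simple : ∀ Q S → All (λ C → len C ≢ 4 → IsSimple C) (map quad Q ++ map circuitCycle S)
  family-simple Q S = All-++⁺ (All-map⁺ (All.universal (λ cd len≢4 → ⊥-elim (len≢4 (quad-len cd))) Q))
                              (All-map⁺ (All.universal (λ c _ → circuitCycle-simple c) S))

  cherryDecomposition : ∀ (G : Multigraph n) → (∀ u v → mult (edges G) u v ≤ 2) → IsVertexCover G VC → Even (edges G) →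
    Σ[ R ∈ List (Edge n) ] Σ[ P ∈ List Cherry ] Σ[ Q ∈ List (Cherry × Cherry) ]
      length R ≤ ∣ VC ∣ * ∣ VC ∣ × length P ≤ ∣ VC ∣ * ∣ VC ∣ × quadEdges Q ++ (R ++ concatMap cherryEdges P) ≋ edges G
  cherryDecomposition G mult≤2 cover even with R , P , Q , inner , ends-unique , G≋ ← cherrySplit G cover even =
    R , P , Q , inner-edges-bound loopless-R inner mult-R≤2 , cherries-bound {P} ends-unique , G≋
    where
    rest = R ++ concatMap cherryEdges P

    loopless-R : Loopless R
    loopless-R = ++⁻ˡ R (++⁻ʳ (quadEdges Q) (All-resp-≋ nonLoop-resp (≋-sym G≋) (loopless G)))

    mult-R≤2 : ∀ u v → mult R u v ≤ 2
    mult-R≤2 u v = begin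
      mult R u v                      ≤⟨ count-≤-++ˡ _ R _ ⟩
      mult rest u v                   ≤⟨ count-≤-++ʳ _ (quadEdges Q) rest ⟩
      mult (quadEdges Q ++ rest) u v  ≡⟨ mult-resp-≋ G≋ u v ⟩
      mult (edges G) u v              ≤⟨ mult≤2 u v ⟩
      2                               ∎
      where open ≤-Reasoning

circuits-bound : ∀ k {s r p} → 2 * s ≤ r + 2 * p → r ≤ k * k → p ≤ k * k → s ≤ 2 * k ^ 2
circuits-bound k {s} {r} {p} 2s≤ r≤ p≤ = *-cancelˡ-≤ 2 (begin
  2 * s                      ≤⟨ 2s≤ ⟩
  r + 2 * p                  ≤⟨ +-mono-≤ (≤-trans r≤ (m≤n+m (k * k) (k * k))) (*-monoʳ-≤ 2 p≤) ⟩
  (k * k + k * k) + 2 * (k * k)  ≡⟨ arithmetic k ⟩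
  2 * (2 * k ^ 2)            ∎)
  where
  open ≤-Reasoning
  four-times : ∀ m → (m + m) + 2 * m ≡ 2 * (2 * m)
  four-times = solve-∀
  arithmetic : ∀ k → (k * k + k * k) + 2 * (k * k) ≡ 2 * (2 * k ^ 2)
  arithmetic k = trans (four-times (k * k)) (cong (λ m → 2 * (2 * (k * m))) (sym (*-identityʳ k)))

mainTheorem5 : ∀ (n : ℕ) (G : Multigraph n) (VC : Subset n)
    → (∀ u v → mult (edges G) u v ≤ 2)
    → IsVertexCover G VC
    → (∀ v → 2 ∣ degree G v)
    → Σ (List (Cycle n)) (λ 𝒞 →
        All (IsCycleIn G) 𝒞
        × length (filter (λ C → ¬? (len C ≟ 4)) 𝒞) ≤ 2 * ∣ VC ∣ ^ 2
        × All (λ C → len C ≢ 4 → IsSimple C) 𝒞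
        × (∀ u v → mult (concatMap cycleEdges 𝒞) u v ≡ mult (edges G) u v))
mainTheorem5 n G VC mult≤2 cover even =
  let R , P , Q , R≤ , P≤ , G≋  = cherryDecomposition VC G mult≤2 cover even
      even-rest , loopless-rest = Even-Loopless-cancelˡ (quadEdges VC Q) G≋ even (loopless G) (λ _ → quads-even VC Q)
      S , S≋ , S-bound          = circuitDecomposition _ even-rest loopless-rest (<-wellFounded _)
      family≋G = ≋-trans (≋-reflexive (family-edges VC Q S)) (≋-trans (≋-++ {xs = quadEdges VC Q} ≋-refl S≋) G≋)
      rest-length = trans (length-++ R) (cong (length R +_) (length-cherryEdges VC P))
  in map (quad VC) Q ++ map circuitCycle S ,
     All-IsCycleIn G _ family≋G ,
     ≤-trans (family-nonfour VC Q S) (circuits-bound ∣ VC ∣ (subst (2 * length S ≤_) rest-length S-bound) R≤ P≤) ,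
     family-simple VC Q S ,
     mult-resp-≋ family≋G
  where open CountEquivalence (edgeDecSetoid n)
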